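{- Let $n,p\in\mathbb{N}$ and $a\in[2^n]=\{1,\dots,2^n\}$. Then there exists an integer $b\in\{0,1,\dots,2^n\}$ such that $C^p[\mathcal{I}_a]=\mathcal{I}_b$.
   Context: $[n]=\{1,\dots,n\}$ and $2^{[n]}$ is its power set. The simplicial ordering on $2^{[n]}$: for distinct $x,y\in 2^{[n]}$, $x<y$ if either $|x|<|y|$, or $|x|=|y|$ and $\min(x\triangle y)\in x$. For $0\le m\le 2^n$, $\mathcal{I}_m$ denotes the set of the first $m$ elements of $2^{[n]}$ in the simplicial ordering (so $\mathcal{I}_0=\emptyset$). For $A\subseteq 2^{[n]}$ and $p\in\mathbb{N}$, $C^p[A]=\{y\in 2^{[n]}: |x\triangle y|\le p \text{ for every } x\in A\}$. -}

module Defs where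

open import Data.Nat using (ℕ; zero; suc; _<_; _≤_; _<?_)
open import Data.Nat.Properties using () renaming (_≟_ to _≟ℕ_)
open import Data.Bool using (Bool; true; false)
open import Data.Fin using (Fin; zero; suc)
open import Data.Fin.Subset using (Subset; _∈_; _∪_; _─_; ∣_∣; inside)
open import Data.Fin.Subset.Properties using (_∈?_)
open import Data.Maybe using (Maybe; just; nothing)
import Data.Maybe as Maybe
open import Data.List using (List; []; _∷_; _++_; map; filter; length)
open import Data.Vec using (Vec; []; _∷_)
open import Data.Product using (Σ; ∃; _×_; _,_)
open import Data.Sum using (_⊎_; inj₁; inj₂)
open import Relation.Binary.PropositionalEquality using (_≡_; refl)
open import Relation.Nullary using (Dec; yes; no; ¬_)
open import Data.Empty using (⊥)

-- Subsets of [n] are 'Subset n' (Vec Bool n); position 'i : Fin n'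
-- corresponds to the element toℕ i + 1 of [n], so the natural order on
-- Fin n is the natural order on [n].

_△_ : ∀ {n} → Subset n → Subset n → Subset n
x △ y = (x ─ y) ∪ (y ─ x)

minElem : ∀ {n} → Subset n → Maybe (Fin n)
minElem [] = nothing
minElem (true ∷ s) = just zero
minElem (false ∷ s) = Maybe.map suc (minElem s)

_<ₛ_ : ∀ {n} → Subset n → Subset n → Set
x <ₛ y = (∣ x ∣ < ∣ y ∣) ⊎ ((∣ x ∣ ≡ ∣ y ∣) × ∃ λ i → (minElem (x △ y) ≡ just i) × (i ∈ x))

_<ₛ?_ : ∀ {n} (x y : Subset n) → Dec (x <ₛ y)
x <ₛ? y with ∣ x ∣ <? ∣ y ∣
... | yes lt = yes (inj₁ lt)
... | no nlt with ∣ x ∣ ≟ℕ ∣ y ∣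
...   | no neq = no λ { (inj₁ lt) → nlt lt ; (inj₂ (eq , _)) → neq eq }
...   | yes eq with minElem (x △ y)
...     | nothing = no λ { (inj₁ lt) → nlt lt ; (inj₂ (_ , (i , () , _))) }
...     | just i with i ∈? x
...       | yes i∈x = yes (inj₂ (eq , (i , refl , i∈x)))
...       | no i∉x = no λ { (inj₁ lt) → nlt lt ; (inj₂ (_ , (j , refl , j∈x))) → i∉x j∈x }

allSubsets : ∀ n → List (Subset n)
allSubsets zero = [] ∷ []
allSubsets (suc n) = map (false ∷_) (allSubsets n) ++ map (true ∷_) (allSubsets n)

rank : ∀ {n} → Subset n → ℕ
rank {n} y = length (filter (λ x → x <ₛ? y) (allSubsets n))

-- I_m : the first m elements of 2^[n] in the simplicial ordering,
-- as a predicate on 2^[n]  (y is among the first m iff rank y < m)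
I : ∀ {n} → ℕ → Subset n → Set
I m y = rank y < m

C : ∀ {n} → ℕ → (Subset n → Set) → Subset n → Set
C p A y = ∀ x → A x → ∣ x △ y ∣ ≤ p

-- If z precedes y in the simplicial order, every x has some x' ≼ x with
-- |x △ z| ≤ |x' △ y|: either x itself works, or a set smaller than x and disjoint from
-- y is far enough from y, or else x is disjoint from z with |z| = |y|, and then the
-- lexicographically first |x|-set avoiding y works (it precedes x because z precedes y).
-- Hence C^p[A] is a down-set whenever A is, and a decidable down-set of the finite
-- total order 2^[n] is the initial segment below its least non-member.
module Submission where

open import Defs
open import Level using (0ℓ)
open import Data.Nat using (ℕ; zero; suc; _+_; _∸_; _^_; _≤_; _<_; z≤n; s≤s; s≤s⁻¹; _≤?_; _<?_)
open import Data.Nat.Properties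
open import Data.Fin using (Fin; zero; suc)
open import Data.Fin.Subset using (Subset; Side; inside; outside; ∣_∣; _∈_)
open import Data.Fin.Subset.Properties using (∣p∣≤n; anySubset?; drop-there)
open import Data.Vec.Base using ([]; _∷_; here; there)
open import Data.Maybe using (Maybe; just)
import Data.Maybe as Maybe
open import Data.List using (List; []; _∷_; _++_; map; filter; length)
open import Data.List.Properties using (length-++; length-map; filter-notAll)
open import Data.List.Membership.Propositional using () renaming (_∈_ to _∈ˡ_)
open import Data.List.Membership.Propositional.Properties using (∈-map⁺; ∈-++⁺ˡ; ∈-++⁺ʳ)
import Data.List.Relation.Unary.Any as Any
open import Data.Product using (∃; _×_; _,_)
open import Data.Sum using (_⊎_; inj₁; inj₂)
import Data.Sum as Sum
open import Data.Empty using (⊥-elim)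
open import Function.Base using (_∘_)
open import Function.Bundles using (_⇔_; mk⇔)
open import Data.Nat.Induction using (<-wellFounded)
open import Induction.WellFounded using (WellFounded; Acc; acc; module Subrelation)
import Relation.Binary.Construct.On as On
open import Relation.Binary.Construct.Closure.Reflexive using (ReflClosure; refl; [_])
import Relation.Binary.Construct.Closure.Reflexive as Refl
open import Relation.Binary.PropositionalEquality using (_≡_; _≢_; refl; sym; trans; cong; cong₂; subst; module ≡-Reasoning)
open import Relation.Binary.Definitions using (tri<; tri≈; tri>)
open import Relation.Nullary using (¬_; Dec; yes; no; ¬?; _×-dec_; decidable-stable)
open import Relation.Unary using (Pred; Decidable)

private
  variable
    n : ℕ

data Lex : Subset n → Subset n → Set where
  here  : {x y : Subset n} → Lex (inside ∷ x) (outside ∷ y)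
  there : {x y : Subset n} {b : Side} → Lex x y → Lex (b ∷ x) (b ∷ y)

Lex-irrefl : {x : Subset n} → ¬ Lex x x
Lex-irrefl (there l) = Lex-irrefl l

Lex-trans : {x y z : Subset n} → Lex x y → Lex y z → Lex x z
Lex-trans here       (there _) = here
Lex-trans (there _)  here      = here
Lex-trans (there l₁) (there l₂) = there (Lex-trans l₁ l₂)

Lex-total : (x y : Subset n) → Lex x y ⊎ ReflClosure Lex y x
Lex-total []             []             = inj₂ refl
Lex-total (inside  ∷ x)  (outside ∷ y)  = inj₁ here
Lex-total (outside ∷ x)  (inside  ∷ y)  = inj₂ [ here ]
Lex-total (inside  ∷ x)  (inside  ∷ y)  = Sum.map there (Refl.map there) (Lex-total x y)
Lex-total (outside ∷ x)  (outside ∷ y)  = Sum.map there (Refl.map there) (Lex-total x y)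

MinDiffIn : Subset n → Subset n → Set
MinDiffIn x y = ∃ λ i → minElem (x △ y) ≡ just i × i ∈ x

minElem-△-∷ : ∀ b (x y : Subset n) → minElem ((b ∷ x) △ (b ∷ y)) ≡ Maybe.map suc (minElem (x △ y))
minElem-△-∷ inside  x y = refl
minElem-△-∷ outside x y = refl

map-suc≡just⁻ : (m : Maybe (Fin n)) {i : Fin (suc n)} → Maybe.map suc m ≡ just i → ∃ λ j → m ≡ just j × i ≡ suc j
map-suc≡just⁻ (just j) refl = j , refl , refl

Lex⇒MinDiffIn : {x y : Subset n} → Lex x y → MinDiffIn x y
Lex⇒MinDiffIn here = zero , refl , here
Lex⇒MinDiffIn {x = b ∷ x} {y = _ ∷ y} (there l) with Lex⇒MinDiffIn l
... | i , eq , i∈x = suc i , trans (minElem-△-∷ b x y) (cong (Maybe.map suc) eq) , there i∈x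

MinDiffIn⇒Lex : (x y : Subset n) → MinDiffIn x y → Lex x y
MinDiffIn⇒Lex (inside  ∷ x) (outside ∷ y) _ = here
MinDiffIn⇒Lex (outside ∷ x) (inside  ∷ y) (zero , refl , ())
MinDiffIn⇒Lex (inside  ∷ x) (inside  ∷ y) (i , eq , i∈x) with map-suc≡just⁻ (minElem (x △ y)) eq
... | j , eq′ , refl = there (MinDiffIn⇒Lex x y (j , eq′ , drop-there i∈x))
MinDiffIn⇒Lex (outside ∷ x) (outside ∷ y) (i , eq , i∈x) with map-suc≡just⁻ (minElem (x △ y)) eq
... | j , eq′ , refl = there (MinDiffIn⇒Lex x y (j , eq′ , drop-there i∈x))

infix 4 _≺_ _≼_

_≺_ : Subset n → Subset n → Set
x ≺ y = ∣ x ∣ < ∣ y ∣ ⊎ (∣ x ∣ ≡ ∣ y ∣ × Lex x y)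

_≼_ : Subset n → Subset n → Set
_≼_ = ReflClosure _≺_

≺⇒<ₛ : {x y : Subset n} → x ≺ y → x <ₛ y
≺⇒<ₛ (inj₁ lt)        = inj₁ lt
≺⇒<ₛ (inj₂ (eq , l))  = inj₂ (eq , Lex⇒MinDiffIn l)

<ₛ⇒≺ : {x y : Subset n} → x <ₛ y → x ≺ y
<ₛ⇒≺ (inj₁ lt)                = inj₁ lt
<ₛ⇒≺ {x = x} {y} (inj₂ (eq , d)) = inj₂ (eq , MinDiffIn⇒Lex x y d)

_≺?_ : (x y : Subset n) → Dec (x ≺ y)
x ≺? y with x <ₛ? y
... | yes x<y = yes (<ₛ⇒≺ x<y)
... | no  x≮y = no (λ x≺y → x≮y (≺⇒<ₛ x≺y))

≺-irrefl : {x : Subset n} → ¬ x ≺ x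
≺-irrefl (inj₁ lt)       = <-irrefl refl lt
≺-irrefl (inj₂ (_ , l))  = Lex-irrefl l

≺-trans : {x y z : Subset n} → x ≺ y → y ≺ z → x ≺ z
≺-trans (inj₁ lt₁)         (inj₁ lt₂)         = inj₁ (<-trans lt₁ lt₂)
≺-trans (inj₁ lt)          (inj₂ (eq , _))    = inj₁ (subst (_ <_) eq lt)
≺-trans (inj₂ (eq , _))    (inj₁ lt)          = inj₁ (subst (_< _) (sym eq) lt)
≺-trans (inj₂ (eq₁ , l₁))  (inj₂ (eq₂ , l₂))  = inj₂ (trans eq₁ eq₂ , Lex-trans l₁ l₂)

≺-total : (x y : Subset n) → x ≺ y ⊎ y ≼ x
≺-total x y with <-cmp ∣ x ∣ ∣ y ∣
... | tri< lt _ _  = inj₁ (inj₁ lt)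
... | tri> _ _ gt  = inj₂ [ inj₁ gt ]
... | tri≈ _ eq _ with Lex-total x y
...   | inj₁ l      = inj₁ (inj₂ (eq , l))
...   | inj₂ refl   = inj₂ refl
...   | inj₂ [ l ]  = inj₂ [ inj₂ (sym eq , l) ]

module _ {A : Set} {P Q : Pred A 0ℓ} (P? : Decidable P) (Q? : Decidable Q) (P⊆Q : ∀ {a} → P a → Q a) where

  length-filter-mono : (xs : List A) → length (filter P? xs) ≤ length (filter Q? xs)
  length-filter-mono []       = z≤n
  length-filter-mono (a ∷ xs) with P? a | Q? a
  ... | yes _  | yes _  = s≤s (length-filter-mono xs)
  ... | yes pa | no ¬qa = ⊥-elim (¬qa (P⊆Q pa))
  ... | no _   | yes _  = m≤n⇒m≤1+n (length-filter-mono xs)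
  ... | no _   | no _   = length-filter-mono xs

  length-filter-mono-< : ∀ {e} (xs : List A) → e ∈ˡ xs → Q e → ¬ P e → length (filter P? xs) < length (filter Q? xs)
  length-filter-mono-< (a ∷ xs) (Any.here refl) qe ¬pe with P? a | Q? a
  ... | yes pe | _      = ⊥-elim (¬pe pe)
  ... | no _   | yes _  = s≤s (length-filter-mono xs)
  ... | no _   | no ¬qe = ⊥-elim (¬qe qe)
  length-filter-mono-< (a ∷ xs) (Any.there e∈xs) qe ¬pe with P? a | Q? a
  ... | yes _  | yes _  = s≤s (length-filter-mono-< xs e∈xs qe ¬pe)
  ... | yes pa | no ¬qa = ⊥-elim (¬qa (P⊆Q pa))
  ... | no _   | yes _  = m≤n⇒m≤1+n (length-filter-mono-< xs e∈xs qe ¬pe)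
  ... | no _   | no _   = length-filter-mono-< xs e∈xs qe ¬pe

∈-allSubsets : (y : Subset n) → y ∈ˡ allSubsets n
∈-allSubsets []                      = Any.here refl
∈-allSubsets {suc n} (outside ∷ y)   = ∈-++⁺ˡ (∈-map⁺ (outside ∷_) (∈-allSubsets y))
∈-allSubsets {suc n} (inside ∷ y)    =
  ∈-++⁺ʳ (map (outside ∷_) (allSubsets n)) (∈-map⁺ (inside ∷_) (∈-allSubsets y))

length-allSubsets : ∀ n → length (allSubsets n) ≡ 2 ^ n
length-allSubsets zero    = refl
length-allSubsets (suc n) = begin
  length (map (outside ∷_) (allSubsets n) ++ map (inside ∷_) (allSubsets n))
    ≡⟨ length-++ (map (outside ∷_) (allSubsets n)) ⟩
  length (map (outside ∷_) (allSubsets n)) + length (map (inside ∷_) (allSubsets n))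
    ≡⟨ cong₂ _+_ (length-map _ (allSubsets n)) (length-map _ (allSubsets n)) ⟩
  length (allSubsets n) + length (allSubsets n)
    ≡⟨ cong₂ _+_ (length-allSubsets n) (trans (length-allSubsets n) (sym (+-identityʳ (2 ^ n)))) ⟩
  2 ^ suc n ∎
  where open ≡-Reasoning

rank-mono : {x y : Subset n} → x ≺ y → rank x < rank y
rank-mono {n} {x} {y} x≺y =
  length-filter-mono-< (_<ₛ? x) (_<ₛ? y) (λ w<x → ≺⇒<ₛ (≺-trans (<ₛ⇒≺ w<x) x≺y))
    (allSubsets n) (∈-allSubsets x) (≺⇒<ₛ x≺y) (λ x<x → ≺-irrefl (<ₛ⇒≺ x<x))

rank-mono-≼ : {x y : Subset n} → x ≼ y → rank x ≤ rank y
rank-mono-≼ refl      = ≤-refl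
rank-mono-≼ [ x≺y ]   = <⇒≤ (rank-mono x≺y)

rank<2^n : (y : Subset n) → rank y < 2 ^ n
rank<2^n {n} y = subst (rank y <_) (length-allSubsets n)
  (filter-notAll (_<ₛ? y) (allSubsets n) (Any.map (λ { refl y<y → ≺-irrefl (<ₛ⇒≺ y<y) }) (∈-allSubsets y)))

rank-<⇒≺ : (x y : Subset n) → rank x < rank y → x ≺ y
rank-<⇒≺ x y rx<ry with ≺-total x y
... | inj₁ x≺y = x≺y
... | inj₂ y≼x = ⊥-elim (<⇒≱ rx<ry (rank-mono-≼ y≼x))

≺-wellFounded : WellFounded (_≺_ {n})
≺-wellFounded = Subrelation.wellFounded rank-mono (On.wellFounded rank <-wellFounded)

∣p△q∣≤∣p∣+∣q∣ : (p q : Subset n) → ∣ p △ q ∣ ≤ ∣ p ∣ + ∣ q ∣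
∣p△q∣≤∣p∣+∣q∣ []            []            = z≤n
∣p△q∣≤∣p∣+∣q∣ (inside  ∷ p) (inside  ∷ q) = ≤-trans (∣p△q∣≤∣p∣+∣q∣ p q) (≤-trans (n≤1+n _) (s≤s (+-monoʳ-≤ ∣ p ∣ (n≤1+n _))))
∣p△q∣≤∣p∣+∣q∣ (inside  ∷ p) (outside ∷ q) = s≤s (∣p△q∣≤∣p∣+∣q∣ p q)
∣p△q∣≤∣p∣+∣q∣ (outside ∷ p) (inside  ∷ q) = subst (suc ∣ p △ q ∣ ≤_) (sym (+-suc _ _)) (s≤s (∣p△q∣≤∣p∣+∣q∣ p q))
∣p△q∣≤∣p∣+∣q∣ (outside ∷ p) (outside ∷ q) = ∣p△q∣≤∣p∣+∣q∣ p q

∣q∣≤∣p△q∣+∣p∣ : (p q : Subset n) → ∣ q ∣ ≤ ∣ p △ q ∣ + ∣ p ∣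
∣q∣≤∣p△q∣+∣p∣ []            []            = z≤n
∣q∣≤∣p△q∣+∣p∣ (inside  ∷ p) (inside  ∷ q) = subst (suc ∣ q ∣ ≤_) (sym (+-suc _ _)) (s≤s (∣q∣≤∣p△q∣+∣p∣ p q))
∣q∣≤∣p△q∣+∣p∣ (inside  ∷ p) (outside ∷ q) = ≤-trans (∣q∣≤∣p△q∣+∣p∣ p q) (≤-trans (n≤1+n _) (s≤s (+-monoʳ-≤ ∣ p △ q ∣ (n≤1+n _))))
∣q∣≤∣p△q∣+∣p∣ (outside ∷ p) (inside  ∷ q) = s≤s (∣q∣≤∣p△q∣+∣p∣ p q)
∣q∣≤∣p△q∣+∣p∣ (outside ∷ p) (outside ∷ q) = ∣q∣≤∣p△q∣+∣p∣ p q

fillOutside : Subset n → ℕ → Subset n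
fillOutside []            k       = []
fillOutside (inside  ∷ y) k       = outside ∷ fillOutside y k
fillOutside (outside ∷ y) zero    = outside ∷ fillOutside y zero
fillOutside (outside ∷ y) (suc k) = inside ∷ fillOutside y k

+-suc-≤-pred : ∀ k m → k + suc m ≤ suc n → k + m ≤ n
+-suc-≤-pred k m h = s≤s⁻¹ (≤-trans (≤-reflexive (sym (+-suc k m))) h)

∣fillOutside∣ : (y : Subset n) (k : ℕ) → k + ∣ y ∣ ≤ n → ∣ fillOutside y k ∣ ≡ k
∣fillOutside∣ []            zero    _       = refl
∣fillOutside∣ (inside  ∷ y) k       h       = ∣fillOutside∣ y k (+-suc-≤-pred k ∣ y ∣ h)
∣fillOutside∣ (outside ∷ y) zero    _       = ∣fillOutside∣ y zero (∣p∣≤n y)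
∣fillOutside∣ (outside ∷ y) (suc k) (s≤s h) = cong suc (∣fillOutside∣ y k h)

∣fillOutside△∣ : (y : Subset n) (k : ℕ) → k + ∣ y ∣ ≤ n → ∣ fillOutside y k △ y ∣ ≡ k + ∣ y ∣
∣fillOutside△∣ []            zero    _       = refl
∣fillOutside△∣ (inside  ∷ y) k       h       =
  trans (cong suc (∣fillOutside△∣ y k (+-suc-≤-pred k ∣ y ∣ h))) (sym (+-suc k ∣ y ∣))
∣fillOutside△∣ (outside ∷ y) zero    _       = ∣fillOutside△∣ y zero (∣p∣≤n y)
∣fillOutside△∣ (outside ∷ y) (suc k) (s≤s h) = cong suc (∣fillOutside△∣ y k h)

fillOutside-zero : (x y : Subset n) → ∣ x ∣ ≡ 0 → fillOutside y 0 ≡ x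
fillOutside-zero []            []            _  = refl
fillOutside-zero (outside ∷ x) (inside  ∷ y) eq = cong (outside ∷_) (fillOutside-zero x y eq)
fillOutside-zero (outside ∷ x) (outside ∷ y) eq = cong (outside ∷_) (fillOutside-zero x y eq)

fillOutside-lex-outside : (x y : Subset n) → ReflClosure Lex (fillOutside (outside ∷ y) ∣ x ∣) (outside ∷ x)
fillOutside-lex-outside x y with ∣ x ∣ in eq
... | zero  = Refl.reflexive (cong (outside ∷_) (fillOutside-zero x y eq))
... | suc _ = [ here ]

-- The size equation says x and z are disjoint; as z precedes y, x and y are then
-- disjoint up to a position outside both, which makes fillOutside y ∣ x ∣ come first.
fillOutside-lexFirst : {x y z : Subset n} → Lex z y → ∣ x △ z ∣ ≡ ∣ x ∣ + ∣ z ∣ →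
                       ReflClosure Lex (fillOutside y ∣ x ∣) x
fillOutside-lexFirst {x = inside ∷ x} {z = inside ∷ z} _ eq =
  ⊥-elim (<⇒≢ (s≤s (≤-trans (∣p△q∣≤∣p∣+∣q∣ x z) (+-monoʳ-≤ ∣ x ∣ (n≤1+n _)))) eq)
fillOutside-lexFirst {x = outside ∷ x} {y = outside ∷ y} here _ = fillOutside-lex-outside x y
fillOutside-lexFirst {x = outside ∷ x} {y = outside ∷ y} (there _) _ = fillOutside-lex-outside x y
fillOutside-lexFirst {x = outside ∷ x} {z = inside ∷ z} (there l) eq =
  Refl.map there (fillOutside-lexFirst l (suc-injective (trans eq (+-suc ∣ x ∣ ∣ z ∣))))
fillOutside-lexFirst {x = inside ∷ x} {z = outside ∷ z} (there l) eq =
  Refl.map there (fillOutside-lexFirst l (suc-injective eq))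

Lex-≼ : {x y : Subset n} → ∣ x ∣ ≡ ∣ y ∣ → ReflClosure Lex x y → x ≼ y
Lex-≼ _  refl    = refl
Lex-≼ eq [ l ]   = [ inj₂ (eq , l) ]

smallerSize-farEnough : ∀ {d t j m n} → d < t → t < j + m → m ≤ d + j → t ≤ n → m ≤ n →
                        ∃ λ k → k < j × t ≤ k + m × k + m ≤ n
smallerSize-farEnough {d} {t} {j} {m} d<t t<j+m m≤d+j t≤n m≤n with m ≤? t
... | yes m≤t = t ∸ m , +-cancelʳ-< m (t ∸ m) j (subst (_< j + m) (sym k+m≡t) t<j+m) ,
                ≤-reflexive (sym k+m≡t) , subst (_≤ _) (sym k+m≡t) t≤n
  where
  k+m≡t : t ∸ m + m ≡ t
  k+m≡t = m∸n+n≡m m≤t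
... | no m≰t = 0 , n≢0⇒n>0 j≢0 , <⇒≤ (≰⇒> m≰t) , m≤n
  where
  j≢0 : j ≢ 0
  j≢0 refl = <-asym (≰⇒> m≰t) (≤-<-trans (subst (m ≤_) (+-identityʳ d) m≤d+j) d<t)

exchange-smaller : (x y : Subset n) {t : ℕ} → ∣ x △ y ∣ < t → t < ∣ x ∣ + ∣ y ∣ → t ≤ n →
                   ∃ λ x′ → x′ ≺ x × t ≤ ∣ x′ △ y ∣
exchange-smaller x y {t} d<t t<j+m t≤n
  with smallerSize-farEnough d<t t<j+m (∣q∣≤∣p△q∣+∣p∣ x y) t≤n (∣p∣≤n y)
... | k , k<j , t≤k+m , k+m≤n =
  fillOutside y k ,
  inj₁ (subst (_< ∣ x ∣) (sym (∣fillOutside∣ y k k+m≤n)) k<j) ,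
  subst (t ≤_) (sym (∣fillOutside△∣ y k k+m≤n)) t≤k+m

exchange-disjoint : {x y z : Subset n} → z ≺ y → ∣ x ∣ + ∣ y ∣ ≤ ∣ x △ z ∣ →
                    ∃ λ x′ → x′ ≼ x × ∣ x △ z ∣ ≤ ∣ x′ △ y ∣
exchange-disjoint {x = x} {y} {z} z≺y j+m≤t = go z≺y
  where
  t≤j+l : ∣ x △ z ∣ ≤ ∣ x ∣ + ∣ z ∣
  t≤j+l = ∣p△q∣≤∣p∣+∣q∣ x z
  j+m≤n : ∣ x ∣ + ∣ y ∣ ≤ _
  j+m≤n = ≤-trans j+m≤t (∣p∣≤n (x △ z))
  go : z ≺ y → ∃ λ x′ → x′ ≼ x × ∣ x △ z ∣ ≤ ∣ x′ △ y ∣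
  go (inj₁ l<m) = ⊥-elim (<⇒≱ l<m (+-cancelˡ-≤ ∣ x ∣ _ _ (≤-trans j+m≤t t≤j+l)))
  go (inj₂ (l≡m , z<y)) =
    fillOutside y ∣ x ∣ ,
    Lex-≼ (∣fillOutside∣ y ∣ x ∣ j+m≤n)
      (fillOutside-lexFirst z<y (≤-antisym t≤j+l (subst (λ l → ∣ x ∣ + l ≤ ∣ x △ z ∣) (sym l≡m) j+m≤t))) ,
    subst (∣ x △ z ∣ ≤_) (sym (∣fillOutside△∣ y ∣ x ∣ j+m≤n)) (subst (λ l → ∣ x △ z ∣ ≤ ∣ x ∣ + l) l≡m t≤j+l)

△-exchange : {y z : Subset n} → z ≺ y → (x : Subset n) → ∃ λ x′ → x′ ≼ x × ∣ x △ z ∣ ≤ ∣ x′ △ y ∣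
△-exchange {y = y} {z} z≺y x with ∣ x △ z ∣ ≤? ∣ x △ y ∣
... | yes t≤d = x , refl , t≤d
... | no t≰d with ∣ x ∣ + ∣ y ∣ ≤? ∣ x △ z ∣
...   | yes j+m≤t = exchange-disjoint z≺y j+m≤t
...   | no j+m≰t with exchange-smaller x y (≰⇒> t≰d) (≰⇒> j+m≰t) (∣p∣≤n (x △ z))
...     | x′ , x′≺x , t≤d′ = x′ , [ x′≺x ] , t≤d′

DownClosed : Pred (Subset n) 0ℓ → Set
DownClosed D = ∀ {x y} → x ≺ y → D y → D x

DownClosed-≼ : {D : Pred (Subset n) 0ℓ} → DownClosed D → {x y : Subset n} → x ≼ y → D y → D x
DownClosed-≼ D↓ refl    Dy = Dy
DownClosed-≼ D↓ [ x≺y ] Dy = D↓ x≺y Dy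

I-downClosed : (a : ℕ) → DownClosed (I {n} a)
I-downClosed a x≺y ry<a = <-trans (rank-mono x≺y) ry<a

C-downClosed : (p : ℕ) {A : Pred (Subset n) 0ℓ} → DownClosed A → DownClosed (C p A)
C-downClosed p A↓ z≺y Cy x Ax with △-exchange z≺y x
... | x′ , x′≼x , d≤d′ = ≤-trans d≤d′ (Cy x′ (DownClosed-≼ A↓ x′≼x Ax))

C-dec : (p : ℕ) {A : Pred (Subset n) 0ℓ} → Decidable A → Decidable (C p A)
C-dec p A? y with anySubset? (λ x → A? x ×-dec ¬? (∣ x △ y ∣ ≤? p))
... | yes (x , Ax , d≰p) = no (λ Cy → d≰p (Cy x Ax))
... | no ∄x              = yes (λ x Ax → decidable-stable (∣ x △ y ∣ ≤? p) (λ d≰p → ∄x (x , Ax , d≰p)))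

least-counterexample : {D : Pred (Subset n) 0ℓ} → Decidable D → {w : Subset n} → Acc _≺_ w → ¬ D w →
                       ∃ λ w* → ¬ D w* × (∀ {y} → y ≺ w* → D y)
least-counterexample D? {w} (acc rs) ¬Dw with anySubset? (λ y → (y ≺? w) ×-dec ¬? (D? y))
... | yes (y , y≺w , ¬Dy) = least-counterexample D? (rs y≺w) ¬Dy
... | no ∄y               = w , ¬Dw , λ {y} y≺w → decidable-stable (D? y) (λ ¬Dy → ∄y (y , y≺w , ¬Dy))

downClosed⇒initialSegment : {D : Pred (Subset n) 0ℓ} → Decidable D → DownClosed D →
                            ∃ λ b → b ≤ 2 ^ n × ((y : Subset n) → D y ⇔ I b y)
downClosed⇒initialSegment {n} {D} D? D↓ with anySubset? (¬? ∘ D?)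
... | no ∄w = 2 ^ n , ≤-refl , λ y →
  mk⇔ (λ _ → rank<2^n y) (λ _ → decidable-stable (D? y) (λ ¬Dy → ∄w (y , ¬Dy)))
... | yes (w , ¬Dw) with least-counterexample D? (≺-wellFounded w) ¬Dw
...   | w* , ¬Dw* , below⇒D = rank w* , <⇒≤ (rank<2^n w*) , λ y → mk⇔ (D⇒below y) (λ ry<rw → below⇒D (rank-<⇒≺ y w* ry<rw))
  where
  D⇒below : ∀ y → D y → rank y < rank w*
  D⇒below y Dy with ≺-total y w*
  ... | inj₁ y≺w*  = rank-mono y≺w*
  ... | inj₂ w*≼y  = ⊥-elim (¬Dw* (DownClosed-≼ D↓ w*≼y Dy))

lemma3p1 : (n p a : ℕ) → 1 ≤ a → a ≤ 2 ^ n →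
    ∃ λ b → (b ≤ 2 ^ n) × ((y : Subset n) → (C p (I a) y ⇔ I b y))
lemma3p1 n p a _ _ =
  downClosed⇒initialSegment (C-dec p (λ x → rank x <? a)) (C-downClosed p (I-downClosed a))
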